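{- In any pre-Hilbert category, monos and $\dagger$-epis form a factorisation system: every morphism $f$ factors as $f=m\circ e$ with $e$ a $\dagger$-epi and $m$ a mono, and this factorisation is unique up to a unique $\dagger$-iso. Consequently, every $\dagger$-epi is a $\dagger$-cokernel of its $\dagger$-kernel, i.e. $e=\mathrm{coker}(\ker(e))$ for every $\dagger$-epi $e$.
   Context: A $\dagger$-category is a category $\mathcal{H}$ with a functor $\dagger:\mathcal{H}^{\mathrm{op}}\to\mathcal{H}$ that is the identity on objects with $f^{\dagger\dagger}=f$. A morphism $m$ is a $\dagger$-mono if $m^\dagger m=\mathrm{id}$, a $\dagger$-epi if $mm^\dagger=\mathrm{id}$, a $\dagger$-iso if both. A pre-Hilbert category is a $\dagger$-category such that: it has finite $\dagger$-biproducts (finite biproducts, including a zero object, with $\pi^\dagger=\kappa$); it has finite $\dagger$-equalisers (equalisers that are $\dagger$-monos); every $\dagger$-mono is a $\dagger$-kernel (a kernel of some morphism); and it is symmetric $\dagger$-monoidal ($(f\otimes g)^\dagger=f^\dagger\otimes g^\dagger$, coherence isomorphisms $\dagger$-isos). Kernels $\ker(f)$ are chosen as $\dagger$-monos ($\dagger$-kernels), and $\dagger$-cokernels are $\mathrm{coker}(f)=\ker(f^\dagger)^\dagger$. -}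

module Defs where

open import Level using (Level; _⊔_) renaming (suc to lsuc)
open import Relation.Binary.PropositionalEquality using (_≡_)
open import Data.Product using (Σ; _×_; _,_; ∃; ∃-syntax)

record Category (o ℓ : Level) : Set (lsuc (o ⊔ ℓ)) where
  infixr 9 _∘_
  field
    Obj : Set o
    Hom : Obj → Obj → Set ℓ
    id  : ∀ {A} → Hom A A
    _∘_ : ∀ {A B C} → Hom B C → Hom A B → Hom A C
    identityˡ : ∀ {A B} (f : Hom A B) → id ∘ f ≡ f
    identityʳ : ∀ {A B} (f : Hom A B) → f ∘ id ≡ f
    assoc : ∀ {A B C D} (h : Hom C D) (g : Hom B C) (f : Hom A B) →
            (h ∘ g) ∘ f ≡ h ∘ (g ∘ f)

record DaggerCategory (o ℓ : Level) : Set (lsuc (o ⊔ ℓ)) where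
  field
    cat : Category o ℓ
  open Category cat
  infix 20 _†
  field
    _†     : ∀ {A B} → Hom A B → Hom B A
    †-id   : ∀ {A} → (id {A}) † ≡ id
    †-∘    : ∀ {A B C} (g : Hom B C) (f : Hom A B) → (g ∘ f) † ≡ f † ∘ g †
    †-invol : ∀ {A B} (f : Hom A B) → (f †) † ≡ f
  open Category cat public

module DaggerNotions {o ℓ : Level} (𝓗 : DaggerCategory o ℓ) where
  open DaggerCategory 𝓗

  Mono : ∀ {A B} → Hom A B → Set (o ⊔ ℓ)
  Mono {A} m = ∀ {X} (g h : Hom X A) → m ∘ g ≡ m ∘ h → g ≡ h

  DaggerMono : ∀ {A B} → Hom A B → Set ℓ
  DaggerMono m = m † ∘ m ≡ id

  DaggerEpi : ∀ {A B} → Hom A B → Set ℓ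
  DaggerEpi m = m ∘ m † ≡ id

  DaggerIso : ∀ {A B} → Hom A B → Set ℓ
  DaggerIso m = DaggerMono m × DaggerEpi m

  record ZeroObject : Set (o ⊔ ℓ) where
    field
      𝟘 : Obj
      ! : ∀ {A} → Hom A 𝟘
      !-unique : ∀ {A} (f : Hom A 𝟘) → f ≡ !
      ¡ : ∀ {A} → Hom 𝟘 A
      ¡-unique : ∀ {A} (f : Hom 𝟘 A) → f ≡ ¡
    0m : ∀ {A B} → Hom A B
    0m = ¡ ∘ !

  module WithZero (Z : ZeroObject) where
    open ZeroObject Z public

    IsKernel : ∀ {A B K} → Hom A B → Hom K A → Set (o ⊔ ℓ)
    IsKernel {A} f k =
      (f ∘ k ≡ 0m) ×
      (∀ {X} (h : Hom X A) → f ∘ h ≡ 0m →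
         Σ (Hom X _) λ u → (k ∘ u ≡ h) × (∀ u′ → k ∘ u′ ≡ h → u′ ≡ u))

    IsCokernel : ∀ {A B C} → Hom A B → Hom B C → Set (o ⊔ ℓ)
    IsCokernel {A} {B} f c =
      (c ∘ f ≡ 0m) ×
      (∀ {X} (h : Hom B X) → h ∘ f ≡ 0m →
         Σ (Hom _ X) λ u → (u ∘ c ≡ h) × (∀ u′ → u′ ∘ c ≡ h → u′ ≡ u))

    record DaggerBiproduct (A B : Obj) : Set (o ⊔ ℓ) where
      field
        A⊕B : Obj
        π₁ : Hom A⊕B A
        π₂ : Hom A⊕B B
        κ₁ : Hom A A⊕B
        κ₂ : Hom B A⊕B
        π₁κ₁ : π₁ ∘ κ₁ ≡ id
        π₂κ₂ : π₂ ∘ κ₂ ≡ id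
        π₁κ₂ : π₁ ∘ κ₂ ≡ 0m
        π₂κ₁ : π₂ ∘ κ₁ ≡ 0m
        product : ∀ {X} (f : Hom X A) (g : Hom X B) →
          Σ (Hom X A⊕B) λ u → ((π₁ ∘ u ≡ f) × (π₂ ∘ u ≡ g)) ×
            (∀ u′ → π₁ ∘ u′ ≡ f → π₂ ∘ u′ ≡ g → u′ ≡ u)
        coproduct : ∀ {X} (f : Hom A X) (g : Hom B X) →
          Σ (Hom A⊕B X) λ u → ((u ∘ κ₁ ≡ f) × (u ∘ κ₂ ≡ g)) ×
            (∀ u′ → u′ ∘ κ₁ ≡ f → u′ ∘ κ₂ ≡ g → u′ ≡ u)
        π₁† : π₁ † ≡ κ₁
        π₂† : π₂ † ≡ κ₂

  IsEqualiser : ∀ {A B E} → Hom A B → Hom A B → Hom E A → Set (o ⊔ ℓ)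
  IsEqualiser {A} f g e =
    (f ∘ e ≡ g ∘ e) ×
    (∀ {X} (h : Hom X A) → f ∘ h ≡ g ∘ h →
       Σ (Hom X _) λ u → (e ∘ u ≡ h) × (∀ u′ → e ∘ u′ ≡ h → u′ ≡ u))

  record SymmetricDaggerMonoidal : Set (o ⊔ ℓ) where
    infixr 10 _⊗₀_ _⊗₁_
    field
      _⊗₀_ : Obj → Obj → Obj
      _⊗₁_ : ∀ {A B C D} → Hom A B → Hom C D → Hom (A ⊗₀ C) (B ⊗₀ D)
      ⊗-id : ∀ {A C} → (id {A}) ⊗₁ (id {C}) ≡ id
      ⊗-∘  : ∀ {A B C A′ B′ C′} (g : Hom B C) (f : Hom A B)
               (g′ : Hom B′ C′) (f′ : Hom A′ B′) →
             (g ∘ f) ⊗₁ (g′ ∘ f′) ≡ (g ⊗₁ g′) ∘ (f ⊗₁ f′)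
      I : Obj
      α : ∀ {A B C} → Hom ((A ⊗₀ B) ⊗₀ C) (A ⊗₀ (B ⊗₀ C))
      λ⇒ : ∀ {A} → Hom (I ⊗₀ A) A
      ρ⇒ : ∀ {A} → Hom (A ⊗₀ I) A
      σ : ∀ {A B} → Hom (A ⊗₀ B) (B ⊗₀ A)
      α-iso : ∀ {A B C} → DaggerIso (α {A} {B} {C})
      λ-iso : ∀ {A} → DaggerIso (λ⇒ {A})
      ρ-iso : ∀ {A} → DaggerIso (ρ⇒ {A})
      σ-iso : ∀ {A B} → DaggerIso (σ {A} {B})
      α-nat : ∀ {A B C A′ B′ C′} (f : Hom A A′) (g : Hom B B′) (h : Hom C C′) →
              α ∘ ((f ⊗₁ g) ⊗₁ h) ≡ (f ⊗₁ (g ⊗₁ h)) ∘ α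
      λ-nat : ∀ {A B} (f : Hom A B) → λ⇒ ∘ (id ⊗₁ f) ≡ f ∘ λ⇒
      ρ-nat : ∀ {A B} (f : Hom A B) → ρ⇒ ∘ (f ⊗₁ id) ≡ f ∘ ρ⇒
      σ-nat : ∀ {A B A′ B′} (f : Hom A A′) (g : Hom B B′) →
              σ ∘ (f ⊗₁ g) ≡ (g ⊗₁ f) ∘ σ
      pentagon : ∀ {A B C D} →
        α {A} {B} {C ⊗₀ D} ∘ α {A ⊗₀ B} {C} {D}
          ≡ (id ⊗₁ α) ∘ (α {A} {B ⊗₀ C} {D} ∘ (α ⊗₁ id))
      triangle : ∀ {A B} → (id {A} ⊗₁ λ⇒ {B}) ∘ α ≡ ρ⇒ ⊗₁ id
      hexagon : ∀ {A B C} →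
        α {B} {C} {A} ∘ (σ {A} {B ⊗₀ C} ∘ α {A} {B} {C})
          ≡ (id ⊗₁ σ) ∘ (α {B} {A} {C} ∘ (σ ⊗₁ id))
      symmetry : ∀ {A B} → σ {B} {A} ∘ σ {A} {B} ≡ id
      †-⊗ : ∀ {A B C D} (f : Hom A B) (g : Hom C D) → (f ⊗₁ g) † ≡ f † ⊗₁ g †

record PreHilbert (o ℓ : Level) : Set (lsuc (o ⊔ ℓ)) where
  field
    𝓗 : DaggerCategory o ℓ
  open DaggerCategory 𝓗 public
  open DaggerNotions 𝓗 public
  field
    zero : ZeroObject
  open WithZero zero public
  field
    biproduct : ∀ A B → DaggerBiproduct A B
    equaliser : ∀ {A B} (f g : Hom A B) →
      Σ Obj λ E → Σ (Hom E A) λ e → IsEqualiser f g e × DaggerMono e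
    †mono⇒†kernel : ∀ {K A} (m : Hom K A) → DaggerMono m →
      Σ Obj λ B → Σ (Hom A B) λ f → IsKernel f m
    monoidal : SymmetricDaggerMonoidal

-- Factor f through the †-cokernel e of its kernel: f = m ∘ e with e a †-epi.
-- The induced m has trivial kernel, and in a pre-Hilbert category that already
-- makes m mono: for m x = m y, the †-equaliser q of x† and y† receives m†, so
-- the morphism z of which q is a kernel kills m†, forcing z = 0 and q split epi.
-- Uniqueness holds because a †-epi e lifts against any mono with diagonal h ∘ e†.
-- Finally a †-epi e, factored through the cokernel of its kernel, differs from
-- it by such a diagonal, so e is itself a cokernel of its kernel.
module Submission where

open import Defs
open import Level using (Level; _⊔_)
open import Relation.Binary.PropositionalEquality
  using (_≡_; sym; trans; cong; cong₂; subst; module ≡-Reasoning)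
open import Data.Product using (Σ; _×_; _,_; proj₁; proj₂)

module DaggerCategoryProperties {o ℓ : Level} (𝓒 : DaggerCategory o ℓ) where
  open DaggerCategory 𝓒
  open DaggerNotions 𝓒
  open ≡-Reasoning

  †-injective : ∀ {A B} {f g : Hom A B} → f † ≡ g † → f ≡ g
  †-injective {f = f} {g} p = begin
    f      ≡⟨ sym (†-invol f) ⟩
    f † †  ≡⟨ cong _† p ⟩
    g † †  ≡⟨ †-invol g ⟩
    g      ∎

  †-swap : ∀ {A B C} {g : Hom B C} {f : Hom A B} {h : Hom A C} →
           g ∘ f ≡ h → f † ∘ g † ≡ h †
  †-swap {g = g} {f} p = trans (sym (†-∘ g f)) (cong _† p)

  †-mono⇒†-epi : ∀ {A B} {m : Hom A B} → DaggerMono m → DaggerEpi (m †)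
  †-mono⇒†-epi {m = m} p = trans (cong (m † ∘_) (†-invol m)) p

  split-epi-cancelʳ : ∀ {A B X} {q : Hom A B} {s : Hom B A} → q ∘ s ≡ id →
                      (a b : Hom B X) → a ∘ q ≡ b ∘ q → a ≡ b
  split-epi-cancelʳ {q = q} {s} qs≡id a b p = begin
    a            ≡⟨ sym (identityʳ a) ⟩
    a ∘ id       ≡⟨ cong (a ∘_) (sym qs≡id) ⟩
    a ∘ (q ∘ s)  ≡⟨ sym (assoc a q s) ⟩
    (a ∘ q) ∘ s  ≡⟨ cong (_∘ s) p ⟩
    (b ∘ q) ∘ s  ≡⟨ assoc b q s ⟩
    b ∘ (q ∘ s)  ≡⟨ cong (b ∘_) qs≡id ⟩
    b ∘ id       ≡⟨ identityʳ b ⟩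
    b            ∎

  †-epi-cancelʳ : ∀ {A B X} {e : Hom A B} → DaggerEpi e →
                  (a b : Hom B X) → a ∘ e ≡ b ∘ e → a ≡ b
  †-epi-cancelʳ = split-epi-cancelʳ

  †-epi-∘-† : ∀ {A B X} {e : Hom A B} → DaggerEpi e → (h : Hom X B) → e ∘ (e † ∘ h) ≡ h
  †-epi-∘-† {e = e} e-†epi h = begin
    e ∘ (e † ∘ h)  ≡⟨ sym (assoc e (e †) h) ⟩
    (e ∘ e †) ∘ h  ≡⟨ cong (_∘ h) e-†epi ⟩
    id ∘ h         ≡⟨ identityˡ h ⟩
    h              ∎

  †-epi⊥mono : ∀ {A B C D} {e : Hom A B} {m : Hom C D} (g : Hom B D) (h : Hom A C) →
               DaggerEpi e → Mono m → g ∘ e ≡ m ∘ h →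
               ((h ∘ e †) ∘ e ≡ h) × (m ∘ (h ∘ e †) ≡ g)
  †-epi⊥mono {e = e} {m} g h e-†epi m-mono square =
      m-mono _ _ (trans (sym (assoc m _ e)) (trans (cong (_∘ e) lower) square)) , lower
    where
    lower : m ∘ (h ∘ e †) ≡ g
    lower = begin
      m ∘ (h ∘ e †)  ≡⟨ sym (assoc m h (e †)) ⟩
      (m ∘ h) ∘ e †  ≡⟨ cong (_∘ e †) (sym square) ⟩
      (g ∘ e) ∘ e †  ≡⟨ assoc g e (e †) ⟩
      g ∘ (e ∘ e †)  ≡⟨ cong (g ∘_) e-†epi ⟩
      g ∘ id         ≡⟨ identityʳ g ⟩
      g              ∎

  †-epi-retraction : ∀ {A B C} {e : Hom A B} {e′ : Hom A C} {u : Hom B C} {v : Hom C B} →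
                     DaggerEpi e → u ∘ e ≡ e′ → v ∘ e′ ≡ e → v ∘ u ≡ id
  †-epi-retraction {e = e} {e′} {u} {v} e-†epi ue≡e′ ve′≡e =
    †-epi-cancelʳ e-†epi (v ∘ u) id (begin
      (v ∘ u) ∘ e  ≡⟨ assoc v u e ⟩
      v ∘ (u ∘ e)  ≡⟨ cong (v ∘_) ue≡e′ ⟩
      v ∘ e′       ≡⟨ ve′≡e ⟩
      e            ≡⟨ sym (identityˡ e) ⟩
      id ∘ e       ∎)

module ZeroProperties {o ℓ : Level} (𝓒 : DaggerCategory o ℓ)
                      (Z : DaggerNotions.ZeroObject 𝓒) where
  open DaggerCategory 𝓒
  open DaggerNotions 𝓒
  open WithZero Z
  open DaggerCategoryProperties 𝓒

  0m-∘ : ∀ {A B X} (g : Hom X A) → 0m {A} {B} ∘ g ≡ 0m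
  0m-∘ g = trans (assoc ¡ ! g) (cong (¡ ∘_) (!-unique (! ∘ g)))

  0m-† : ∀ {A B} → 0m {A} {B} † ≡ 0m
  0m-† = trans (†-∘ ¡ !) (cong₂ _∘_ (¡-unique (! †)) (!-unique (¡ †)))

  zero-∘ʳ : ∀ {A B C X} {g : Hom B C} {f : Hom A B} (h : Hom X A) →
            g ∘ f ≡ 0m → g ∘ (f ∘ h) ≡ 0m
  zero-∘ʳ {g = g} {f} h gf≡0 = trans (sym (assoc g f h)) (trans (cong (_∘ h) gf≡0) (0m-∘ h))

  †-zero : ∀ {A B C} {g : Hom B C} {f : Hom A B} → g ∘ f ≡ 0m → f † ∘ g † ≡ 0m
  †-zero gf≡0 = trans (†-swap gf≡0) 0m-†

  kernel†⇒cokernel : ∀ {A B K} {f : Hom A B} {k : Hom K B} →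
                     IsKernel (f †) k → IsCokernel f (k †)
  kernel†⇒cokernel {f = f} {k} (f†k≡0 , universal) =
      subst (λ x → k † ∘ x ≡ 0m) (†-invol f) (†-zero f†k≡0) , factor
    where
    factor : ∀ {X} (h : Hom _ X) → h ∘ f ≡ 0m →
             Σ (Hom _ X) λ u → (u ∘ k † ≡ h) × (∀ u′ → u′ ∘ k † ≡ h → u′ ≡ u)
    factor h hf≡0 with universal (h †) (†-zero hf≡0)
    ... | u , ku≡h† , unique = u † , trans (†-swap ku≡h†) (†-invol h) , unique†
      where
      unique† : ∀ u′ → u′ ∘ k † ≡ h → u′ ≡ u †
      unique† u′ u′k†≡h = †-injective (trans (unique (u′ †) ku′†≡h†) (sym (†-invol u)))
        where
        ku′†≡h† : k ∘ u′ † ≡ h †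
        ku′†≡h† = subst (λ x → x ∘ u′ † ≡ h †) (†-invol k) (†-swap u′k†≡h)

module PreHilbertProperties {o ℓ : Level} (C : PreHilbert o ℓ) where
  open PreHilbert C
  open DaggerCategoryProperties 𝓗
  open ZeroProperties 𝓗 zero
  open ≡-Reasoning

  record Kernel {A B} (f : Hom A B) : Set (o ⊔ ℓ) where
    field
      obj : Obj
      arr : Hom obj A
      isKernel : IsKernel f arr
      isDaggerMono : DaggerMono arr

  record Cokernel {A B} (f : Hom A B) : Set (o ⊔ ℓ) where
    field
      obj : Obj
      arr : Hom B obj
      isCokernel : IsCokernel f arr
      isDaggerEpi : DaggerEpi arr

  equaliser-with-0⇒kernel : ∀ {A B K} {f : Hom A B} {k : Hom K A} →
                            IsEqualiser f 0m k → IsKernel f k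
  equaliser-with-0⇒kernel {k = k} (fk≡0k , universal) =
    trans fk≡0k (0m-∘ k) , λ h fh≡0 → universal h (trans fh≡0 (sym (0m-∘ h)))

  kernel : ∀ {A B} (f : Hom A B) → Kernel f
  kernel f with equaliser f 0m
  ... | K , k , k-isEqualiser , k-†mono = record
    { obj = K ; arr = k ; isKernel = equaliser-with-0⇒kernel k-isEqualiser ; isDaggerMono = k-†mono }

  cokernel : ∀ {A B} (f : Hom A B) → Cokernel f
  cokernel f = record
    { obj = obj ; arr = arr † ; isCokernel = kernel†⇒cokernel isKernel
    ; isDaggerEpi = †-mono⇒†-epi isDaggerMono }
    where open Kernel (kernel (f †))

  HasTrivialKernel : ∀ {A B} → Hom A B → Set (o ⊔ ℓ)
  HasTrivialKernel {A} m = ∀ {X} (h : Hom X A) → m ∘ h ≡ 0m → h ≡ 0m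

  trivial-kernel⇒trivial-†-cokernel : ∀ {A B X} {m : Hom A B} {z : Hom A X} →
    HasTrivialKernel m → z ∘ m † ≡ 0m → z ≡ 0m
  trivial-kernel⇒trivial-†-cokernel {m = m} {z} trivial zm†≡0 =
    †-injective (trans (trivial (z †) mz†≡0) (sym 0m-†))
    where
    mz†≡0 : m ∘ z † ≡ 0m
    mz†≡0 = subst (λ x → x ∘ z † ≡ 0m) (†-invol m) (†-zero zm†≡0)

  factors-m†⇒split-epi : ∀ {A B Q} {m : Hom A B} {q : Hom Q A} {v : Hom B Q} →
    HasTrivialKernel m → DaggerMono q → q ∘ v ≡ m † → Σ (Hom A Q) λ s → q ∘ s ≡ id
  factors-m†⇒split-epi {A} {Q = Q} {q = q} {v} trivial q-†mono qv≡m†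
    with †mono⇒†kernel q q-†mono
  ... | _ , z , (zq≡0 , universal) = proj₁ split , proj₁ (proj₂ split)
    where
    z≡0 : z ≡ 0m
    z≡0 = trivial-kernel⇒trivial-†-cokernel trivial
            (subst (λ x → z ∘ x ≡ 0m) qv≡m† (zero-∘ʳ v zq≡0))
    split : Σ (Hom A Q) λ s → (q ∘ s ≡ id) × (∀ s′ → q ∘ s′ ≡ id → s′ ≡ s)
    split = universal id (trans (identityʳ z) z≡0)

  trivial-kernel⇒mono : ∀ {A B} {m : Hom A B} → HasTrivialKernel m → Mono m
  trivial-kernel⇒mono {m = m} trivial x y mx≡my
    with equaliser (x †) (y †)
  ... | _ , q , (x†q≡y†q , universal) , q-†mono
    with universal (m †) (trans (†-swap mx≡my) (†-∘ m y))
  ... | v , qv≡m† , _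
    with factors-m†⇒split-epi trivial q-†mono qv≡m†
  ... | s , qs≡id = †-injective (split-epi-cancelʳ qs≡id (x †) (y †) x†q≡y†q)

  module Image {A B} (f : Hom A B) where
    open Kernel (kernel f) public using ()
      renaming (arr to k; isKernel to k-isKernel)
    open Cokernel (cokernel k) public using ()
      renaming (obj to M; arr to e; isCokernel to e-isCokernel; isDaggerEpi to e-†epi)

    fk≡0 : f ∘ k ≡ 0m
    fk≡0 = proj₁ k-isKernel

    m : Hom M B
    m = proj₁ (proj₂ e-isCokernel f fk≡0)

    m∘e≡f : m ∘ e ≡ f
    m∘e≡f = proj₁ (proj₂ (proj₂ e-isCokernel f fk≡0))

    m-trivial-kernel : HasTrivialKernel m
    m-trivial-kernel h mh≡0 with proj₂ k-isKernel (e † ∘ h) fe†h≡0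
      where
      fe†h≡0 : f ∘ (e † ∘ h) ≡ 0m
      fe†h≡0 = begin
        f ∘ (e † ∘ h)        ≡⟨ cong (_∘ (e † ∘ h)) (sym m∘e≡f) ⟩
        (m ∘ e) ∘ (e † ∘ h)  ≡⟨ assoc m e (e † ∘ h) ⟩
        m ∘ (e ∘ (e † ∘ h))  ≡⟨ cong (m ∘_) (†-epi-∘-† e-†epi h) ⟩
        m ∘ h                ≡⟨ mh≡0 ⟩
        0m                   ∎
    ... | u , ku≡e†h , _ = begin
      h              ≡⟨ sym (†-epi-∘-† e-†epi h) ⟩
      e ∘ (e † ∘ h)  ≡⟨ cong (e ∘_) (sym ku≡e†h) ⟩
      e ∘ (k ∘ u)    ≡⟨ zero-∘ʳ u (proj₁ e-isCokernel) ⟩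
      0m             ∎

    m-mono : Mono m
    m-mono = trivial-kernel⇒mono m-trivial-kernel

  factorise : ∀ {A B} (f : Hom A B) →
    Σ Obj λ M → Σ (Hom A M) λ e → Σ (Hom M B) λ m → (f ≡ m ∘ e) × DaggerEpi e × Mono m
  factorise f = M , e , m , sym m∘e≡f , e-†epi , m-mono
    where open Image f

  factorisation-unique :
    ∀ {A B M M′} (e : Hom A M) (m : Hom M B) (e′ : Hom A M′) (m′ : Hom M′ B) →
    DaggerEpi e → Mono m → DaggerEpi e′ → Mono m′ → m ∘ e ≡ m′ ∘ e′ →
    Σ (Hom M M′) λ u → DaggerIso u × (u ∘ e ≡ e′) × (m′ ∘ u ≡ m) ×
      (∀ u′ → DaggerIso u′ → u′ ∘ e ≡ e′ → m′ ∘ u′ ≡ m → u′ ≡ u)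
  factorisation-unique e m e′ m′ e-†epi m-mono e′-†epi m′-mono square =
      u , (u†u≡id , uu†≡id) , ue≡e′ , m′u≡m
        , λ u′ _ u′e≡e′ _ → †-epi-cancelʳ e-†epi u′ u (trans u′e≡e′ (sym ue≡e′))
    where
    u : Hom _ _
    u = e′ ∘ e †
    u† : u † ≡ e ∘ e′ †
    u† = trans (†-∘ e′ (e †)) (cong (_∘ e′ †) (†-invol e))
    ue≡e′ : u ∘ e ≡ e′
    ue≡e′ = proj₁ (†-epi⊥mono m e′ e-†epi m′-mono square)
    m′u≡m : m′ ∘ u ≡ m
    m′u≡m = proj₂ (†-epi⊥mono m e′ e-†epi m′-mono square)
    u†e′≡e : u † ∘ e′ ≡ e
    u†e′≡e = trans (cong (_∘ e′) u†) (proj₁ (†-epi⊥mono m′ e e′-†epi m-mono (sym square)))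
    u†u≡id : u † ∘ u ≡ id
    u†u≡id = †-epi-retraction e-†epi ue≡e′ u†e′≡e
    uu†≡id : u ∘ u † ≡ id
    uu†≡id = †-epi-retraction e′-†epi u†e′≡e ue≡e′

  †-epi-is-cokernel-of-kernel : ∀ {A B K} {e : Hom A B} {k : Hom K A} →
    DaggerEpi e → IsKernel e k → IsCokernel k e
  †-epi-is-cokernel-of-kernel {A} {B} {e = e} {k} e-†epi (ek≡0 , k-universal) = ek≡0 , factor
    where
    module I = Image e
    diagonal : (I.e ∘ e †) ∘ e ≡ I.e
    diagonal = proj₁ (†-epi⊥mono id I.e e-†epi I.m-mono (trans (identityˡ e) (sym I.m∘e≡f)))
    factor : ∀ {X} (h : Hom A X) → h ∘ k ≡ 0m →
             Σ (Hom B X) λ w → (w ∘ e ≡ h) × (∀ w′ → w′ ∘ e ≡ h → w′ ≡ w)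
    factor h hk≡0 with k-universal I.k I.fk≡0
    ... | t , kt≡I-k , _
      with proj₂ I.e-isCokernel h (subst (λ x → h ∘ x ≡ 0m) kt≡I-k (zero-∘ʳ t hk≡0))
    ... | w , wI-e≡h , _ =
        w ∘ (I.e ∘ e †) , we≡h , λ w′ w′e≡h → †-epi-cancelʳ e-†epi w′ _ (trans w′e≡h (sym we≡h))
      where
      we≡h : (w ∘ (I.e ∘ e †)) ∘ e ≡ h
      we≡h = begin
        (w ∘ (I.e ∘ e †)) ∘ e  ≡⟨ assoc w _ e ⟩
        w ∘ ((I.e ∘ e †) ∘ e)  ≡⟨ cong (w ∘_) diagonal ⟩
        w ∘ I.e                ≡⟨ wI-e≡h ⟩
        h                      ∎

lemma3 : ∀ {o ℓ} (C : PreHilbert o ℓ) → let open PreHilbert C in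
    (∀ {A B} (f : Hom A B) →
      Σ Obj λ M → Σ (Hom A M) λ e → Σ (Hom M B) λ m →
        (f ≡ m ∘ e) × DaggerEpi e × Mono m)
    × (∀ {A B M M′} (e : Hom A M) (m : Hom M B) (e′ : Hom A M′) (m′ : Hom M′ B) →
        DaggerEpi e → Mono m → DaggerEpi e′ → Mono m′ → m ∘ e ≡ m′ ∘ e′ →
        Σ (Hom M M′) λ u → DaggerIso u × (u ∘ e ≡ e′) × (m′ ∘ u ≡ m) ×
          (∀ u′ → DaggerIso u′ → u′ ∘ e ≡ e′ → m′ ∘ u′ ≡ m → u′ ≡ u))
    × (∀ {A B K} (e : Hom A B) (k : Hom K A) →
        DaggerEpi e → IsKernel e k → DaggerMono k → IsCokernel k e)
lemma3 C =
    factorise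
  , factorisation-unique
  , λ e k e-†epi k-isKernel _ → †-epi-is-cokernel-of-kernel e-†epi k-isKernel
  where open PreHilbertProperties C
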